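{- Let $G=(V,E)$ be a digraph with block graph $F$. Let $u$ and $v$ be vertices of $V$ that are not vertex-resilient but are connected by a path $P$ in $F$. Then, for any vertex $w\in V\setminus\{u,v\}$ on $P$, $u$ and $v$ are not strongly connected in the digraph $G\setminus w$.
   Context: Two distinct vertices $v,w$ of $G$ are vertex-resilient, written $v\leftrightarrow_{\mathrm{vr}} w$, if for every vertex $z\notin\{v,w\}$, $v$ and $w$ lie in the same strongly connected component of $G\setminus z$. A vertex-resilient block is a maximal set $B\subseteq V$ with $|B|\ge 2$ such that $u\leftrightarrow_{\mathrm{vr}} v$ for all distinct $u,v\in B$. The block graph $F$ of $G$ is the undirected bipartite graph whose vertex set consists of the vertices of $V$ together with one block node for each vertex-resilient block of $G$, and whose edges are the pairs $\{u,B\}$ with $u\in B$. -}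

module Defs where

open import Data.Nat using (ℕ; _≥_)
open import Data.Fin using (Fin)
open import Data.Fin.Subset using (Subset; _∈_; _⊆_; ∣_∣)
open import Data.Sum using (_⊎_; inj₁; inj₂)
open import Data.Product using (_×_)
open import Data.List using (List; []; _∷_)
open import Relation.Binary.PropositionalEquality using (_≡_; _≢_)

record Digraph (n : ℕ) : Set₁ where
  field
    Arc : Fin n → Fin n → Set
open Digraph public

module _ {n : ℕ} (G : Digraph n) where

  -- Reach∖ z x y : there is a directed path from x to y in G ∖ z
  -- (all vertices of the path, including x and y, are different from z).
  data Reach∖ (z : Fin n) : Fin n → Fin n → Set where
    here : ∀ {x} → x ≢ z → Reach∖ z x x
    step : ∀ {x y w} → x ≢ z → Arc G x y → Reach∖ z y w → Reach∖ z x w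

  SameSCC∖ : Fin n → Fin n → Fin n → Set
  SameSCC∖ z x y = Reach∖ z x y × Reach∖ z y x

  VR : Fin n → Fin n → Set
  VR v w = v ≢ w × (∀ z → z ≢ v → z ≢ w → SameSCC∖ z v w)

  PairwiseVR : Subset n → Set
  PairwiseVR B = ∀ x y → x ∈ B → y ∈ B → x ≢ y → VR x y

  IsBlock : Subset n → Set
  IsBlock B = (∣ B ∣ ≥ 2) × PairwiseVR B
            × (∀ B′ → B ⊆ B′ → ∣ B′ ∣ ≥ 2 → PairwiseVR B′ → B′ ≡ B)

  -- Nodes of the block graph F: vertices of G (inj₁) and block nodes (inj₂),
  -- a block node being identified with its vertex-resilient block.
  FNode : Set
  FNode = Fin n ⊎ Subset n

  data FEdge : FNode → FNode → Set where
    vb : ∀ {u B} → IsBlock B → u ∈ B → FEdge (inj₁ u) (inj₂ B)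
    bv : ∀ {u B} → IsBlock B → u ∈ B → FEdge (inj₂ B) (inj₁ u)

  data FWalk : FNode → FNode → Set where
    [_]  : ∀ a → FWalk a a
    _∷⟨_⟩_ : ∀ a {b c} → FEdge a b → FWalk b c → FWalk a c

  nodes : ∀ {a b} → FWalk a b → List FNode
  nodes [ a ] = a ∷ []
  nodes (a ∷⟨ _ ⟩ p) = a ∷ nodes p

module Submission where

-- Suppose u and v were strongly connected in G ∖ w, where
-- w ∉ {u, v} lies on a simple path P = u – … – a – B₁ – w – B₂ – b – … – v of
-- the block graph F.  Two vertices of a common block stay strongly connected
-- after deleting any third vertex, so the parts of P before and after w give
-- a ~ u and v ~ b in G ∖ w; hence a ~ b in G ∖ w.  Then every x ∈ B₁ and
-- y ∈ B₂ are strongly connected after deleting any z ∉ {x, y}: route through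
-- w if z ≠ w, and through a and b if z = w.  So B₁ ∪ B₂ is pairwise
-- vertex-resilient and maximality of blocks forces B₁ = B₂, contradicting the
-- simplicity of P.

open import Defs
open import Data.Nat using (ℕ)
open import Data.Nat.Properties using (≤-trans)
open import Data.Fin using (Fin; _≟_)
open import Data.Fin.Subset using (Subset; _∪_; _⊆_) renaming (_∈_ to _∈ₛ_)
open import Data.Fin.Subset.Properties using (p⊆p∪q; q⊆p∪q; x∈p∪q⁻; p⊆q⇒∣p∣≤∣q∣)
open import Data.Product using (_,_; proj₁; proj₂)
open import Data.Sum using (inj₁; inj₂)
open import Data.List.Membership.Propositional using (_∈_)
open import Data.List.Relation.Unary.All using (All; []; _∷_)
open import Data.List.Relation.Unary.Any using (here; there)
open import Data.List.Relation.Unary.AllPairs using (_∷_)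
open import Data.List.Relation.Unary.Unique.Propositional using (Unique)
open import Relation.Nullary using (¬_; yes; no)
open import Relation.Binary.PropositionalEquality
  using (_≡_; _≢_; refl; sym; trans; cong; ≢-sym)

module _ {n : ℕ} {G : Digraph n} where

  reach-trans : ∀ {z x y t} → Reach∖ G z x y → Reach∖ G z y t → Reach∖ G z x t
  reach-trans (here _)       q = q
  reach-trans (step x≢z e p) q = step x≢z e (reach-trans p q)

  scc-refl : ∀ {z x} → x ≢ z → SameSCC∖ G z x x
  scc-refl x≢z = here x≢z , here x≢z

  scc-sym : ∀ {z x y} → SameSCC∖ G z x y → SameSCC∖ G z y x
  scc-sym (xy , yx) = yx , xy

  scc-trans : ∀ {z x y t} → SameSCC∖ G z x y → SameSCC∖ G z y t → SameSCC∖ G z x t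
  scc-trans (xy , yx) (yt , ty) = reach-trans xy yt , reach-trans ty yx

  block-scc : ∀ {B x y z} → IsBlock G B → x ∈ₛ B → y ∈ₛ B → x ≢ z → y ≢ z →
              SameSCC∖ G z x y
  block-scc {x = x} {y} isB x∈B y∈B x≢z y≢z with x ≟ y
  ... | yes refl = scc-refl x≢z
  ... | no  x≢y  = proj₂ (proj₁ (proj₂ isB) x y x∈B y∈B x≢y) _ (≢-sym x≢z) (≢-sym y≢z)

  -- Maximality of a block, with the size condition discharged: any pairwise
  -- vertex-resilient superset of a block equals it.
  block-maximal : ∀ {B B′} → IsBlock G B → B ⊆ B′ → PairwiseVR G B′ → B′ ≡ B
  block-maximal {B} {B′} (size , _ , maximal) B⊆B′ =
    maximal B′ B⊆B′ (≤-trans size (p⊆q⇒∣p∣≤∣q∣ {p = B} {q = B′} B⊆B′))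

  module Junction {B₁ B₂ : Subset n} {w a b : Fin n}
                  (isB₁ : IsBlock G B₁) (isB₂ : IsBlock G B₂)
                  (w∈B₁ : w ∈ₛ B₁) (w∈B₂ : w ∈ₛ B₂)
                  (a∈B₁ : a ∈ₛ B₁) (b∈B₂ : b ∈ₛ B₂)
                  (a≢w : a ≢ w) (b≢w : b ≢ w) (a~b : SameSCC∖ G w a b) where

    -- Every x ∈ B₁ and y ∈ B₂ stay strongly connected in G ∖ z (z ∉ {x, y}):
    -- through w when z ≠ w, and through the link a ~ b when z = w.
    cross-scc : ∀ {x y} → x ∈ₛ B₁ → y ∈ₛ B₂ → ∀ z → z ≢ x → z ≢ y →
                SameSCC∖ G z x y
    cross-scc x∈B₁ y∈B₂ z z≢x z≢y with z ≟ w
    ... | yes refl = scc-trans (block-scc isB₁ x∈B₁ a∈B₁ (≢-sym z≢x) a≢w)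
                       (scc-trans a~b (block-scc isB₂ b∈B₂ y∈B₂ b≢w (≢-sym z≢y)))
    ... | no  z≢w  = scc-trans (block-scc isB₁ x∈B₁ w∈B₁ (≢-sym z≢x) (≢-sym z≢w))
                       (block-scc isB₂ w∈B₂ y∈B₂ (≢-sym z≢w) (≢-sym z≢y))

    union-pairwiseVR : PairwiseVR G (B₁ ∪ B₂)
    union-pairwiseVR x y x∈∪ y∈∪ x≢y with x∈p∪q⁻ B₁ B₂ x∈∪ | x∈p∪q⁻ B₁ B₂ y∈∪
    ... | inj₁ x∈B₁ | inj₁ y∈B₁ = proj₁ (proj₂ isB₁) x y x∈B₁ y∈B₁ x≢y
    ... | inj₂ x∈B₂ | inj₂ y∈B₂ = proj₁ (proj₂ isB₂) x y x∈B₂ y∈B₂ x≢y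
    ... | inj₁ x∈B₁ | inj₂ y∈B₂ = x≢y , cross-scc x∈B₁ y∈B₂
    ... | inj₂ x∈B₂ | inj₁ y∈B₁ =
      x≢y , λ z z≢x z≢y → scc-sym (cross-scc y∈B₁ x∈B₂ z z≢y z≢x)

    blocks-coincide : B₁ ≡ B₂
    blocks-coincide =
      trans (sym (block-maximal isB₁ (p⊆p∪q B₂) union-pairwiseVR))
            (block-maximal isB₂ (q⊆p∪q B₁ B₂) union-pairwiseVR)

  head-avoids : ∀ {z x y} (P : FWalk G (inj₁ x) (inj₁ y)) →
                All (inj₁ z ≢_) (nodes G P) → x ≢ z
  head-avoids [ _ ]         (z≢x ∷ _) x≡z = z≢x (cong inj₁ (sym x≡z))
  head-avoids (_ ∷⟨ _ ⟩ _) (z≢x ∷ _) x≡z = z≢x (cong inj₁ (sym x≡z))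

  -- An F-walk avoiding z joins its endpoints inside one SCC of G ∖ z, since
  -- consecutive vertices on it share a block.
  walk-scc : ∀ {z x y} (P : FWalk G (inj₁ x) (inj₁ y)) →
             All (inj₁ z ≢_) (nodes G P) → SameSCC∖ G z x y
  walk-scc [ _ ] (z≢x ∷ []) = scc-refl (head-avoids [ _ ] (z≢x ∷ []))
  walk-scc (_ ∷⟨ vb isB x∈B ⟩ (_ ∷⟨ bv _ c∈B ⟩ rest)) (z≢x ∷ _ ∷ avoid) =
    scc-trans (block-scc isB x∈B c∈B (head-avoids [ _ ] (z≢x ∷ [])) (head-avoids rest avoid))
              (walk-scc rest avoid)

  -- The local picture of a simple F-walk from x to v around an interior vertex
  -- w:  x – … – a – B₁ – w – B₂ – b – … – v, with B₁ ≠ B₂ and both ends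
  -- already linked to their neighbours of w in G ∖ w.
  record Crossing (w x v : Fin n) : Set where
    field
      {a b}     : Fin n
      {B₁ B₂}   : Subset n
      isB₁      : IsBlock G B₁
      isB₂      : IsBlock G B₂
      w∈B₁      : w ∈ₛ B₁
      w∈B₂      : w ∈ₛ B₂
      a∈B₁      : a ∈ₛ B₁
      b∈B₂      : b ∈ₛ B₂
      a≢w       : a ≢ w
      b≢w       : b ≢ w
      B₁≢B₂     : B₁ ≢ B₂
      x~a       : SameSCC∖ G w x a
      b~v       : SameSCC∖ G w b v

  extend : ∀ {w x c v} → SameSCC∖ G w x c → Crossing w c v → Crossing w x v
  extend x~c r = record
    { isB₁ = isB₁ ; isB₂ = isB₂ ; w∈B₁ = w∈B₁ ; w∈B₂ = w∈B₂ ; a∈B₁ = a∈B₁ ; b∈B₂ = b∈B₂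
    ; a≢w = a≢w ; b≢w = b≢w ; B₁≢B₂ = B₁≢B₂ ; x~a = scc-trans x~c x~a ; b~v = b~v }
    where open Crossing r

  -- Every vertex w ∉ {x, v} on a simple F-walk from x to v yields a Crossing.
  -- Induction along the walk; the part after w avoids w by simplicity.
  crossing : ∀ {w x v} (P : FWalk G (inj₁ x) (inj₁ v)) → Unique (nodes G P) →
             inj₁ w ∈ nodes G P → x ≢ w → w ≢ v → Crossing w x v
  crossing [ _ ] _ (here refl) x≢w _ with () ← x≢w refl
  crossing (_ ∷⟨ vb _ _ ⟩ (_ ∷⟨ bv _ _ ⟩ _)) _ (here refl) x≢w _ with () ← x≢w refl
  crossing {w} (_ ∷⟨ vb _ _ ⟩ (_ ∷⟨ bv {u = c} _ _ ⟩ _)) _ (there (there _)) _ _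
    with c ≟ w
  crossing (_ ∷⟨ vb isB x∈B ⟩ (_ ∷⟨ bv _ c∈B ⟩ rest)) (_ ∷ _ ∷ uniq) (there (there w∈rest))
           x≢w w≢v | no c≢w =
    extend (block-scc isB x∈B c∈B x≢w c≢w) (crossing rest uniq w∈rest c≢w w≢v)
  crossing (_ ∷⟨ _ ⟩ (_ ∷⟨ _ ⟩ [ _ ])) _ (there (there _)) _ w≢v | yes refl
    with () ← w≢v refl
  crossing (_ ∷⟨ vb isB₁ x∈B₁ ⟩ (_ ∷⟨ bv _ w∈B₁ ⟩ (_ ∷⟨ vb isB₂ w∈B₂ ⟩ (_ ∷⟨ bv _ b∈B₂ ⟩ rest))))
           (_ ∷ (_ ∷ B₁≢B₂ ∷ _) ∷ (_ ∷ avoid) ∷ _) (there (there _)) x≢w _ | yes refl =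
    record { isB₁ = isB₁ ; isB₂ = isB₂ ; w∈B₁ = w∈B₁ ; w∈B₂ = w∈B₂
           ; a∈B₁ = x∈B₁ ; b∈B₂ = b∈B₂ ; a≢w = x≢w ; b≢w = head-avoids rest avoid
           ; B₁≢B₂ = λ B₁≡B₂ → B₁≢B₂ (cong inj₂ B₁≡B₂) ; x~a = scc-refl x≢w ; b~v = walk-scc rest avoid }

lemma6 : ∀ {n : ℕ} (G : Digraph n) (u v : Fin n) →
    ¬ VR G u v →
    (P : FWalk G (inj₁ u) (inj₁ v)) → Unique (nodes G P) →
    (w : Fin n) → w ≢ u → w ≢ v → inj₁ w ∈ nodes G P →
    ¬ SameSCC∖ G w u v
lemma6 G u v _ P simple w w≢u w≢v w∈P u~v =
  B₁≢B₂ (Junction.blocks-coincide isB₁ isB₂ w∈B₁ w∈B₂ a∈B₁ b∈B₂ a≢w b≢w a~b)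
  where
    open Crossing (crossing P simple w∈P (≢-sym w≢u) w≢v)
    a~b : SameSCC∖ G w a b
    a~b = scc-trans (scc-sym x~a) (scc-trans u~v (scc-sym b~v))
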